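{- Let $m>1$ be an integer that is not a perfect square and let $\ell\ge 5$ be an integer. Define $q=2\ell-4$ if $\ell\equiv 1$ or $3\pmod 4$, $q=\ell-2$ if $\ell\equiv 2\pmod 4$, and $q=\ell/2-1$ if $\ell\equiv 0\pmod 4$. Suppose there exist integers $x>0$, $y>0$ with $x^2-my^2=1$ such that either $$x+my\equiv -1 \pmod q \quad\text{and}\quad x+y\equiv -1\pmod q,$$ or $$my-x\equiv -1 \pmod q \quad\text{and}\quad x-y\equiv -1\pmod q.$$ Then there exist positive integers $r,s$ with $P(\ell,r)=m\,P(\ell,s)$. Moreover, in that case there are infinitely many such pairs $(r,s)$.
   Context: For integers $\ell\ge 3$ and $r\ge 1$, the $r$-th $\ell$-gonal number is $P(\ell,r)=\frac{(\ell-2)r^2-(\ell-4)r}{2}$. -}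

module Defs where

open import Data.Nat using (ℕ; _+_; _*_; _∸_; _/_; _%_; _≡ᵇ_)
open import Data.Bool using (if_then_else_)

-- The r-th ℓ-gonal number P(ℓ,r) = ((ℓ-2)r² - (ℓ-4)r)/2.
-- For ℓ ≥ 4 the numerator is a non-negative even natural number, so truncated
-- subtraction and floor division by 2 are exact here.
P : ℕ → ℕ → ℕ
P ℓ r = ((ℓ ∸ 2) * (r * r) ∸ (ℓ ∸ 4) * r) / 2

qOf : ℕ → ℕ
qOf ℓ =
  if (ℓ % 4) ≡ᵇ 0 then (ℓ / 2) ∸ 1
  else if (ℓ % 4) ≡ᵇ 2 then ℓ ∸ 2
  else 2 * ℓ ∸ 4

module Submission where

-- Write ℓ = 4 + c and D = 2(ℓ − 2). Completing the square gives 8(ℓ − 2)·P(ℓ, r) + c² = (Dr − c)², so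
-- P(ℓ, r) = m·P(ℓ, s) follows from Dr − c = cA and Ds − c = cB with A² − mB² = 1 − m. Such pairs are
-- A + B√m = (±1 + √m)(x + y√m) for a solution of x² − my² = 1, and the hypothesis says exactly that
-- A ≡ B ≡ −1 (mod q); q is chosen so that D divides cq, which makes r = c(A + 1)/D and s integers.
-- For infinitely many solutions: ε = x + y√m is invertible, so its powers are purely periodic modulo q
-- (pigeonhole on residue pairs); the powers ε^(1 + kt) ≡ ε satisfy the same congruences and have
-- unbounded y.

module PolygonalNumbers where
  open import Defs
  open import Data.Nat using (ℕ; zero; suc; _+_; _*_; _∸_; _/_; _<_; _≤_; z≤n; s≤s; z<s; >-nonZero)
  open import Data.Nat.Divisibility using (_∣_; divides; ∣-trans; *-monoʳ-∣)
  open import Data.Nat.Properties using (+-cancelʳ-≡; *-cancelˡ-≡; *-comm; m+n∸n≡m; m≤n*m; m<m+n; *-mono-<; <-≤-trans; ≤-<-trans; <-irrefl)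
  open import Data.Nat.DivMod using (m*n/n≡m)
  open import Data.Nat.Tactic.RingSolver using (solve-∀; solve)
  open import Data.List using (_∷_; [])
  open import Data.Product using (_×_; _,_; ∃₂)
  open import Relation.Binary.PropositionalEquality using (_≡_; refl; sym; trans; cong; subst; module ≡-Reasoning)
  open import Data.Empty using (⊥-elim)
  open ≡-Reasoning

  -- p = P (4 + c) r, stated without truncated subtraction and division.
  record Polygonal (c r p : ℕ) : Set where
    constructor polygonal
    field twice : 2 * p + c * r ≡ (2 + c) * (r * r)

  -- T n = n(n − 1)/2; it exhibits the numerator of P (4 + c) r as the even number 2(c·T r + r²) + cr.
  T : ℕ → ℕ
  T zero = 0
  T (suc n) = n + T n

  2*T+n≡n*n : ∀ n → 2 * T n + n ≡ n * n
  2*T+n≡n*n zero = refl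
  2*T+n≡n*n (suc n) = begin
    2 * (n + T n) + suc n        ≡⟨ ring n (T n) ⟩
    (2 * T n + n) + (n + suc n)  ≡⟨ cong (_+ (n + suc n)) (2*T+n≡n*n n) ⟩
    n * n + (n + suc n)          ≡⟨ solve (n ∷ []) ⟩
    suc n * suc n                ∎
    where
    ring : ∀ n t → 2 * (n + t) + suc n ≡ (2 * t + n) + (n + suc n)
    ring = solve-∀

  P-polygonal : ∀ c r → Polygonal c r (P (4 + c) r)
  P-polygonal c r = polygonal (begin
    2 * P (4 + c) r + c * r  ≡⟨ cong (λ p → 2 * p + c * r) P≡h ⟩
    2 * h + c * r            ≡⟨ cong (_+ c * r) (*-comm 2 h) ⟩
    h * 2 + c * r            ≡⟨ numerator ⟨
    (2 + c) * (r * r)        ∎)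
    where
    h = c * T r + r * r
    numerator : (2 + c) * (r * r) ≡ h * 2 + c * r
    numerator = begin
      (2 + c) * (r * r)              ≡⟨ solve (c ∷ r ∷ []) ⟩
      c * (r * r) + 2 * (r * r)      ≡⟨ cong (λ z → c * z + 2 * (r * r)) (2*T+n≡n*n r) ⟨
      c * (2 * T r + r) + 2 * (r * r) ≡⟨ ring c (T r) r ⟩
      h * 2 + c * r                  ∎
      where
      ring : ∀ c t r → c * (2 * t + r) + 2 * (r * r) ≡ (c * t + r * r) * 2 + c * r
      ring = solve-∀
    P≡h : P (4 + c) r ≡ h
    P≡h = begin
      ((2 + c) * (r * r) ∸ c * r) / 2  ≡⟨ cong (λ n → (n ∸ c * r) / 2) numerator ⟩
      (h * 2 + c * r ∸ c * r) / 2      ≡⟨ cong (_/ 2) (m+n∸n≡m (h * 2) (c * r)) ⟩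
      (h * 2) / 2                      ≡⟨ m*n/n≡m h 2 ⟩
      h                                ∎

  -- 8(ℓ − 2)·P(ℓ, r) + c² = (2(ℓ − 2)r − c)² for ℓ = 4 + c, rearranged to avoid subtraction.
  complete-square : ∀ {c r p} → Polygonal c r p →
                    8 * (2 + c) * p + 2 * c * (2 * (2 + c) * r) ≡ (2 * (2 + c) * r) * (2 * (2 + c) * r)
  complete-square {c} {r} {p} (polygonal twice) = begin
    8 * (2 + c) * p + 2 * c * (2 * (2 + c) * r)  ≡⟨ solve (c ∷ p ∷ r ∷ []) ⟩
    4 * (2 + c) * (2 * p + c * r)                ≡⟨ cong (4 * (2 + c) *_) twice ⟩
    4 * (2 + c) * ((2 + c) * (r * r))            ≡⟨ solve (c ∷ r ∷ []) ⟩
    (2 * (2 + c) * r) * (2 * (2 + c) * r)        ∎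

  shifted-square : ∀ {c r p A} → Polygonal c r p → 2 * (2 + c) * r ≡ c * (A + 1) → 8 * (2 + c) * p + c * c ≡ (c * A) * (c * A)
  shifted-square {c} {r} {p} {A} p-polygonal r≡ = +-cancelʳ-≡ (2 * c * c * A + c * c) _ _ (begin
    8 * (2 + c) * p + c * c + (2 * c * c * A + c * c)  ≡⟨ solve (c ∷ p ∷ A ∷ []) ⟩
    8 * (2 + c) * p + 2 * c * (c * (A + 1))            ≡⟨ cong (λ z → 8 * (2 + c) * p + 2 * c * z) r≡ ⟨
    8 * (2 + c) * p + 2 * c * (2 * (2 + c) * r)        ≡⟨ complete-square p-polygonal ⟩
    (2 * (2 + c) * r) * (2 * (2 + c) * r)              ≡⟨ cong (λ z → z * z) r≡ ⟩
    (c * (A + 1)) * (c * (A + 1))                      ≡⟨ solve (c ∷ A ∷ []) ⟩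
    (c * A) * (c * A) + (2 * c * c * A + c * c)        ∎)

  polygonal-ratio : ∀ {c m A B r s p p′} → Polygonal c r p → Polygonal c s p′ →
                    2 * (2 + c) * r ≡ c * (A + 1) → 2 * (2 + c) * s ≡ c * (B + 1) →
                    A * A + m ≡ m * (B * B) + 1 → p ≡ m * p′
  polygonal-ratio {c} {m} {A} {B} {p = p} {p′} p-polygonal p′-polygonal r≡ s≡ AB-norm =
    *-cancelˡ-≡ p (m * p′) (8 * (2 + c)) (+-cancelʳ-≡ (c * c + c * c * m) _ _ (begin
      8 * (2 + c) * p + (c * c + c * c * m)         ≡⟨ solve (c ∷ p ∷ m ∷ []) ⟩
      (8 * (2 + c) * p + c * c) + c * c * m         ≡⟨ cong (_+ c * c * m) (shifted-square p-polygonal r≡) ⟩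
      (c * A) * (c * A) + c * c * m                 ≡⟨ solve (c ∷ A ∷ m ∷ []) ⟩
      c * c * (A * A + m)                           ≡⟨ cong (c * c *_) AB-norm ⟩
      c * c * (m * (B * B) + 1)                     ≡⟨ solve (c ∷ B ∷ m ∷ []) ⟩
      m * ((c * B) * (c * B)) + c * c               ≡⟨ cong (λ z → m * z + c * c) (shifted-square p′-polygonal s≡) ⟨
      m * (8 * (2 + c) * p′ + c * c) + c * c        ≡⟨ solve (c ∷ p′ ∷ m ∷ []) ⟩
      8 * (2 + c) * (m * p′) + (c * c + c * c * m)  ∎))

  quotient-positive : ∀ {n d s} → 0 < n → n ≡ s * d → 0 < s
  quotient-positive {s = zero}  0<n n≡0 = ⊥-elim (<-irrefl refl (subst (0 <_) n≡0 0<n))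
  quotient-positive {s = suc s} _   _   = s≤s z≤n

  polygonal-solution : ∀ c m q {A B} → 0 < c → 2 * (2 + c) ∣ c * q → q ∣ A + 1 → q ∣ B + 1 →
                       A * A + m ≡ m * (B * B) + 1 →
                       ∃₂ λ r s → A < 2 * (2 + c) * r × 0 < s × P (4 + c) r ≡ m * P (4 + c) s
  polygonal-solution c m q {A} {B} 0<c D∣cq q∣A+1 q∣B+1 AB-norm
    with divides r cA≡ ← ∣-trans D∣cq (*-monoʳ-∣ c q∣A+1)
       | divides s cB≡ ← ∣-trans D∣cq (*-monoʳ-∣ c q∣B+1) =
    r , s , A<Dr , s-positive ,
    polygonal-ratio (P-polygonal c r) (P-polygonal c s) (Dx≡ r cA≡) (Dx≡ s cB≡) AB-norm
    where
    D = 2 * (2 + c)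
    Dx≡ : ∀ x {n} → n ≡ x * D → D * x ≡ n
    Dx≡ x n≡ = trans (*-comm D x) (sym n≡)
    A<Dr : A < D * r
    A<Dr = <-≤-trans (m<m+n A z<s) (subst (A + 1 ≤_) (sym (Dx≡ r cA≡)) (m≤n*m (A + 1) c {{>-nonZero 0<c}}))
    s-positive : 0 < s
    s-positive = quotient-positive (*-mono-< 0<c (≤-<-trans z≤n (m<m+n B z<s))) cB≡

module Modulus where
  open import Defs
  open import Data.Nat using (ℕ; zero; suc; _+_; _*_; _∸_; _/_; _%_; _<_; _≤_; _≡ᵇ_; z≤n; s≤s)
  open import Data.Nat.DivMod using (m*n/n≡m; [m+kn]%n≡m%n; m≡m%n+[m/n]*n; m%n<n)
  open import Data.Nat.Properties using (m+n∸n≡m)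
  open import Data.Nat.Divisibility using (_∣_; divides)
  open import Data.Nat.Tactic.RingSolver using (solve)
  open import Data.Bool using (if_then_else_)
  open import Data.List using (_∷_; [])
  open import Data.Product using (_×_; _,_)
  open import Relation.Binary.PropositionalEquality using (_≡_; sym; trans; cong; subst)

  Admissible : ℕ → ℕ → Set
  Admissible ℓ q = 0 < q × 2 * (ℓ ∸ 2) ∣ (ℓ ∸ 4) * q

  qOfResidue : ℕ → ℕ → ℕ
  qOfResidue b ℓ = if b ≡ᵇ 0 then ℓ / 2 ∸ 1 else if b ≡ᵇ 2 then ℓ ∸ 2 else 2 * ℓ ∸ 4

  qOf-residue : ∀ b a → qOf (b + a * 4) ≡ qOfResidue (b % 4) (b + a * 4)
  qOf-residue b a = cong (λ b′ → qOfResidue b′ (b + a * 4)) ([m+kn]%n≡m%n b a 4)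

  admissible-by : ∀ ℓ q j → qOf ℓ ≡ suc q → (ℓ ∸ 4) * suc q ≡ j * (2 * (ℓ ∸ 2)) → Admissible ℓ (qOf ℓ)
  admissible-by ℓ q j qOf≡ eq = subst (Admissible ℓ) (sym qOf≡) (s≤s z≤n , divides j eq)

  admissible-residue : ∀ b a → b < 4 → 5 ≤ b + a * 4 → Admissible (b + a * 4) (qOf (b + a * 4))
  admissible-residue 0 zero _ ()
  admissible-residue 0 (suc zero) _ (s≤s (s≤s (s≤s (s≤s ()))))
  admissible-residue 0 (suc (suc a)) _ _ =
    admissible-by (8 + a * 4) (2 + a * 2) (1 + a) (trans (qOf-residue 0 (2 + a)) q≡) eq
    where
    eq : (4 + a * 4) * (3 + a * 2) ≡ (1 + a) * (2 * (6 + a * 4))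
    eq = solve (a ∷ [])
    8+4a≡ : 8 + a * 4 ≡ (4 + a * 2) * 2
    8+4a≡ = solve (a ∷ [])
    q≡ : (8 + a * 4) / 2 ∸ 1 ≡ 3 + a * 2
    q≡ = trans (cong (λ n → n / 2 ∸ 1) 8+4a≡) (cong (_∸ 1) (m*n/n≡m (4 + a * 2) 2))
  admissible-residue 1 zero _ (s≤s ())
  admissible-residue 1 (suc a) _ _ =
    admissible-by (5 + a * 4) (5 + a * 8) (1 + a * 4) (trans (qOf-residue 1 (suc a)) q≡) eq
    where
    eq : (1 + a * 4) * (6 + a * 8) ≡ (1 + a * 4) * (2 * (3 + a * 4))
    eq = solve (a ∷ [])
    2ℓ≡ : 2 * (5 + a * 4) ≡ (6 + a * 8) + 4
    2ℓ≡ = solve (a ∷ [])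
    q≡ : 2 * (5 + a * 4) ∸ 4 ≡ 6 + a * 8
    q≡ = trans (cong (_∸ 4) 2ℓ≡) (m+n∸n≡m (6 + a * 8) 4)
  admissible-residue 2 zero _ (s≤s (s≤s ()))
  admissible-residue 2 (suc a) _ _ =
    admissible-by (6 + a * 4) (3 + a * 4) (1 + a * 2) (qOf-residue 2 (suc a)) eq
    where
    eq : (2 + a * 4) * (4 + a * 4) ≡ (1 + a * 2) * (2 * (4 + a * 4))
    eq = solve (a ∷ [])
  admissible-residue 3 zero _ (s≤s (s≤s (s≤s ())))
  admissible-residue 3 (suc a) _ _ =
    admissible-by (7 + a * 4) (9 + a * 8) (3 + a * 4) (trans (qOf-residue 3 (suc a)) q≡) eq
    where
    eq : (3 + a * 4) * (10 + a * 8) ≡ (3 + a * 4) * (2 * (5 + a * 4))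
    eq = solve (a ∷ [])
    2ℓ≡ : 2 * (7 + a * 4) ≡ (10 + a * 8) + 4
    2ℓ≡ = solve (a ∷ [])
    q≡ : 2 * (7 + a * 4) ∸ 4 ≡ 10 + a * 8
    q≡ = trans (cong (_∸ 4) 2ℓ≡) (m+n∸n≡m (10 + a * 8) 4)
  admissible-residue (suc (suc (suc (suc _)))) _ (s≤s (s≤s (s≤s (s≤s ())))) _

  qOf-admissible : ∀ ℓ → 5 ≤ ℓ → Admissible ℓ (qOf ℓ)
  qOf-admissible ℓ 5≤ℓ = subst (λ n → Admissible n (qOf n)) (sym ℓ≡)
    (admissible-residue (ℓ % 4) (ℓ / 4) (m%n<n ℓ 4) (subst (5 ≤_) ℓ≡ 5≤ℓ))
    where ℓ≡ = m≡m%n+[m/n]*n ℓ 4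

module QuadraticIntegers where
  open import Data.Nat as ℕ using (ℕ; zero; suc)
  open import Data.Nat.Properties using (+-suc)
  open import Data.Integer using (ℤ; +_; _+_; _-_; _*_; -_; 0ℤ; 1ℤ)
  open import Data.Integer.Divisibility.Signed using (_∣_; divides; ∣m∣n⇒∣m+n; ∣m⇒∣-m; ∣n⇒∣m*n)
  open import Data.Integer.Tactic.RingSolver using (solve-∀)
  open import Data.Product using (_×_; _,_; proj₁; proj₂)
  open import Relation.Binary.PropositionalEquality using (_≡_; refl; sym; trans; cong; cong₂; subst; module ≡-Reasoning)
  open ≡-Reasoning

  infix 4 _≡_mod_

  record _≡_mod_ (a b n : ℤ) : Set where
    constructor mod-by
    field divides-difference : n ∣ a - b

  module _ {n : ℤ} where

    mod-by-≡ : ∀ {a b d} → n ∣ d → d ≡ a - b → a ≡ b mod n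
    mod-by-≡ n∣d d≡ = mod-by (subst (n ∣_) d≡ n∣d)

    mod-refl : ∀ {a} → a ≡ a mod n
    mod-refl {a} = mod-by (divides 0ℤ (ring a n))
      where
      ring : ∀ a n → a - a ≡ 0ℤ * n
      ring = solve-∀

    mod-sym : ∀ {a b} → a ≡ b mod n → b ≡ a mod n
    mod-sym {a} {b} (mod-by a≡b) = mod-by-≡ (∣m⇒∣-m a≡b) (ring a b)
      where
      ring : ∀ a b → - (a - b) ≡ b - a
      ring = solve-∀

    mod-trans : ∀ {a b c} → a ≡ b mod n → b ≡ c mod n → a ≡ c mod n
    mod-trans {a} {b} {c} (mod-by a≡b) (mod-by b≡c) = mod-by-≡ (∣m∣n⇒∣m+n a≡b b≡c) (ring a b c)
      where
      ring : ∀ a b c → (a - b) + (b - c) ≡ a - c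
      ring = solve-∀

    +-cong-mod : ∀ {a a′ b b′} → a ≡ a′ mod n → b ≡ b′ mod n → a + b ≡ a′ + b′ mod n
    +-cong-mod {a} {a′} {b} {b′} (mod-by a≡) (mod-by b≡) = mod-by-≡ (∣m∣n⇒∣m+n a≡ b≡) (ring a a′ b b′)
      where
      ring : ∀ a a′ b b′ → (a - a′) + (b - b′) ≡ (a + b) - (a′ + b′)
      ring = solve-∀

    neg-cong-mod : ∀ {a a′} → a ≡ a′ mod n → - a ≡ - a′ mod n
    neg-cong-mod {a} {a′} (mod-by a≡) = mod-by-≡ (∣m⇒∣-m a≡) (ring a a′)
      where
      ring : ∀ a a′ → - (a - a′) ≡ - a - - a′
      ring = solve-∀

    -‿cong-mod : ∀ {a a′ b b′} → a ≡ a′ mod n → b ≡ b′ mod n → a - b ≡ a′ - b′ mod n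
    -‿cong-mod a≡ b≡ = +-cong-mod a≡ (neg-cong-mod b≡)

    *-cong-mod : ∀ {a a′ b b′} → a ≡ a′ mod n → b ≡ b′ mod n → a * b ≡ a′ * b′ mod n
    *-cong-mod {a} {a′} {b} {b′} (mod-by a≡) (mod-by b≡) =
      mod-by-≡ (∣m∣n⇒∣m+n (∣n⇒∣m*n b a≡) (∣n⇒∣m*n a′ b≡)) (ring a a′ b b′)
      where
      ring : ∀ a a′ b b′ → b * (a - a′) + a′ * (b - b′) ≡ a * b - a′ * b′
      ring = solve-∀

    ∣-resp-mod : ∀ {a b} → a ≡ b mod n → n ∣ b → n ∣ a
    ∣-resp-mod {a} {b} (mod-by a≡b) n∣b = subst (n ∣_) (ring a b) (∣m∣n⇒∣m+n a≡b n∣b)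
      where
      ring : ∀ a b → (a - b) + b ≡ a
      ring = solve-∀

  infix 4 _≋_mod_

  record _≋_mod_ (u v : ℤ × ℤ) (n : ℤ) : Set where
    constructor _,_
    field
      fst : proj₁ u ≡ proj₁ v mod n
      snd : proj₂ u ≡ proj₂ v mod n

  module _ {n : ℤ} where

    ≋-refl : ∀ {u} → u ≋ u mod n
    ≋-refl = mod-refl , mod-refl

    ≋-reflexive : ∀ {u v} → u ≡ v → u ≋ v mod n
    ≋-reflexive refl = ≋-refl

    ≋-sym : ∀ {u v} → u ≋ v mod n → v ≋ u mod n
    ≋-sym (a≡ , b≡) = mod-sym a≡ , mod-sym b≡

    ≋-trans : ∀ {u v w} → u ≋ v mod n → v ≋ w mod n → u ≋ w mod n
    ≋-trans (a≡ , b≡) (a′≡ , b′≡) = mod-trans a≡ a′≡ , mod-trans b≡ b′≡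

  -- (a , b) stands for a + b√d.
  module QuadraticRing (d : ℤ) where

    infixr 7 _·_
    infixr 8 _^_

    _·_ : ℤ × ℤ → ℤ × ℤ → ℤ × ℤ
    (a , b) · (c , e) = (a * c + d * (b * e) , a * e + b * c)

    1# : ℤ × ℤ
    1# = (1ℤ , 0ℤ)

    _^_ : ℤ × ℤ → ℕ → ℤ × ℤ
    u ^ zero = 1#
    u ^ suc k = u · u ^ k

    norm : ℤ × ℤ → ℤ
    norm (a , b) = a * a - d * (b * b)

    conj : ℤ × ℤ → ℤ × ℤ
    conj (a , b) = (a , - b)

    ·-assoc : ∀ u v w → (u · v) · w ≡ u · (v · w)
    ·-assoc (a , b) (c , e) (f , g) = cong₂ _,_ (fst a b c e f g d) (snd a b c e f g d)
      where
      fst : ∀ a b c e f g d → (a * c + d * (b * e)) * f + d * ((a * e + b * c) * g) ≡ a * (c * f + d * (e * g)) + d * (b * (c * g + e * f))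
      fst = solve-∀
      snd : ∀ a b c e f g d → (a * c + d * (b * e)) * g + (a * e + b * c) * f ≡ a * (c * g + e * f) + b * (c * f + d * (e * g))
      snd = solve-∀

    ·-identityˡ : ∀ u → 1# · u ≡ u
    ·-identityˡ (a , b) = cong₂ _,_ (fst a b d) (snd a b)
      where
      fst : ∀ a b d → 1ℤ * a + d * (0ℤ * b) ≡ a
      fst = solve-∀
      snd : ∀ a b → 1ℤ * b + 0ℤ * a ≡ b
      snd = solve-∀

    ·-identityʳ : ∀ u → u · 1# ≡ u
    ·-identityʳ (a , b) = cong₂ _,_ (fst a b d) (snd a b)
      where
      fst : ∀ a b d → a * 1ℤ + d * (b * 0ℤ) ≡ a
      fst = solve-∀
      snd : ∀ a b → a * 0ℤ + b * 1ℤ ≡ b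
      snd = solve-∀

    ^-+ : ∀ u i j → u ^ (i ℕ.+ j) ≡ u ^ i · u ^ j
    ^-+ u zero    j = sym (·-identityˡ (u ^ j))
    ^-+ u (suc i) j = trans (cong (u ·_) (^-+ u i j)) (sym (·-assoc u (u ^ i) (u ^ j)))

    norm-· : ∀ u v → norm (u · v) ≡ norm u * norm v
    norm-· (a , b) (c , e) = brahmagupta a b c e d
      where
      brahmagupta : ∀ a b c e d → (a * c + d * (b * e)) * (a * c + d * (b * e)) - d * ((a * e + b * c) * (a * e + b * c))
                                  ≡ (a * a - d * (b * b)) * (c * c - d * (e * e))
      brahmagupta = solve-∀

    norm-^ : ∀ u k → norm u ≡ 1ℤ → norm (u ^ k) ≡ 1ℤ
    norm-^ u zero    _      = norm-1# d
      where
      norm-1# : ∀ d → 1ℤ * 1ℤ - d * (0ℤ * 0ℤ) ≡ 1ℤ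
      norm-1# = solve-∀
    norm-^ u (suc k) norm≡1 = trans (norm-· u (u ^ k)) (cong₂ _*_ norm≡1 (norm-^ u k norm≡1))

    conj-· : ∀ u → norm u ≡ 1ℤ → conj u · u ≡ 1#
    conj-· (a , b) norm≡1 = cong₂ _,_ (trans (fst a b d) norm≡1) (snd a b)
      where
      fst : ∀ a b d → a * a + d * (- b * b) ≡ a * a - d * (b * b)
      fst = solve-∀
      snd : ∀ a b → a * b + - b * a ≡ 0ℤ
      snd = solve-∀

    module _ {n : ℤ} where

      ·-cong : ∀ {u u′ v v′} → u ≋ u′ mod n → v ≋ v′ mod n → u · v ≋ u′ · v′ mod n
      ·-cong {_ , _} {_ , _} {_ , _} {_ , _} (a≡ , b≡) (c≡ , e≡) =
        +-cong-mod (*-cong-mod a≡ c≡) (*-cong-mod (mod-refl {a = d}) (*-cong-mod b≡ e≡)) ,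
        +-cong-mod (*-cong-mod a≡ e≡) (*-cong-mod b≡ c≡)

      ^-cancelˡ : ∀ {u v} → v · u ≡ 1# → ∀ i {j k} → u ^ (i ℕ.+ j) ≋ u ^ (i ℕ.+ k) mod n → u ^ j ≋ u ^ k mod n
      ^-cancelˡ         vu≡1 zero    u^j≋u^k = u^j≋u^k
      ^-cancelˡ {u} {v} vu≡1 (suc i) {j} {k} u^j≋u^k = ^-cancelˡ {u} {v} vu≡1 i
        (≋-trans (≋-reflexive (sym (cancel j))) (≋-trans (·-cong (≋-refl {u = v}) u^j≋u^k) (≋-reflexive (cancel k))))
        where
        cancel : ∀ j → v · u ^ (suc i ℕ.+ j) ≡ u ^ (i ℕ.+ j)
        cancel j = begin
          v · (u · u ^ (i ℕ.+ j))   ≡⟨ ·-assoc v u _ ⟨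
          (v · u) · u ^ (i ℕ.+ j)   ≡⟨ cong (_· u ^ (i ℕ.+ j)) vu≡1 ⟩
          1# · u ^ (i ℕ.+ j)        ≡⟨ ·-identityˡ _ ⟩
          u ^ (i ℕ.+ j)             ∎

      ^-periodic : ∀ {u} p → u ^ p ≋ 1# mod n → ∀ t → u ^ suc (t ℕ.* p) ≋ u mod n
      ^-periodic {u} p u^p≋1 zero    = ≋-reflexive (·-identityʳ u)
      ^-periodic {u} p u^p≋1 (suc t) =
        ≋-trans (≋-reflexive split) (≋-trans (·-cong u^p≋1 (^-periodic p u^p≋1 t)) (≋-reflexive (·-identityˡ u)))
        where
        split : u ^ suc (p ℕ.+ t ℕ.* p) ≡ u ^ p · u ^ suc (t ℕ.* p)
        split = trans (cong (u ^_) (sym (+-suc p (t ℕ.* p)))) (^-+ u p (suc (t ℕ.* p)))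

module PellOrbits where
  open QuadraticIntegers
  open import Data.Nat as ℕ using (ℕ; zero; suc; NonZero; _%_; z≤n; s≤s; >-nonZero)
  import Data.Nat.Properties as ℕ
  open import Data.Nat.DivMod using (m%n<n)
  open import Data.Integer using (ℤ; +_; _+_; _-_; _*_; 1ℤ; _/ℕ_)
  open import Data.Integer.DivMod using (a≡a%ℕn+[a/ℕn]*n)
  open import Data.Integer.Properties using (pos-+; pos-*)
  open import Data.Integer.Divisibility.Signed using (divides)
  open import Data.Integer.Tactic.RingSolver using (solve-∀)
  open import Data.Fin using (Fin; toℕ; fromℕ<; combine)
  open import Data.Fin.Properties using (pigeonhole; combine-injective; toℕ-fromℕ<)
  open import Data.Product using (_×_; _,_; proj₁; proj₂; ∃; ∃₂)
  open import Relation.Binary.PropositionalEquality using (_≡_; refl; sym; trans; cong; cong₂; subst; subst₂; module ≡-Reasoning)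
  open ≡-Reasoning

  %-≡⇒≡-mod : ∀ q .{{_ : NonZero q}} {a b} → a % q ≡ b % q → + a ≡ + b mod + q
  %-≡⇒≡-mod q {a} {b} a%q≡b%q = mod-by (divides (+ a /ℕ q - + b /ℕ q) (begin
    + a - + b                                          ≡⟨ cong₂ _-_ (a≡a%ℕn+[a/ℕn]*n (+ a) q) (a≡a%ℕn+[a/ℕn]*n (+ b) q) ⟩
    (+ (a % q) + + a /ℕ q * + q) - (+ (b % q) + + b /ℕ q * + q) ≡⟨ cong (λ r → (+ (a % q) + + a /ℕ q * + q) - (+ r + + b /ℕ q * + q)) (sym a%q≡b%q) ⟩
    (+ (a % q) + + a /ℕ q * + q) - (+ (a % q) + + b /ℕ q * + q) ≡⟨ ring (+ (a % q)) (+ a /ℕ q) (+ b /ℕ q) (+ q) ⟩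
    (+ a /ℕ q - + b /ℕ q) * + q                         ∎))
    where
    ring : ∀ r s t q → (r + s * q) - (r + t * q) ≡ (s - t) * q
    ring = solve-∀

  module PellOrbit (m x y : ℕ) where
    open QuadraticRing (+ m)

    ε : ℤ × ℤ
    ε = (+ x , + y)

    -- Powers of x + y√m computed in ℕ, so that their coordinates are visibly non-negative.
    ε·_ : ℕ × ℕ → ℕ × ℕ
    ε· (a , b) = (x ℕ.* a ℕ.+ m ℕ.* (y ℕ.* b) , x ℕ.* b ℕ.+ y ℕ.* a)

    power : ℕ → ℕ × ℕ
    power zero = (1 , 0)
    power (suc k) = ε· power k

    toℤ² : ℕ × ℕ → ℤ × ℤ
    toℤ² (a , b) = (+ a , + b)

    toℤ²-ε· : ∀ v → toℤ² (ε· v) ≡ ε · toℤ² v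
    toℤ²-ε· (a , b) = cong₂ _,_
      (trans (pos-+ (x ℕ.* a) _) (cong₂ _+_ (pos-* x a) (trans (pos-* m _) (cong (+ m *_) (pos-* y b)))))
      (trans (pos-+ (x ℕ.* b) _) (cong₂ _+_ (pos-* x b) (pos-* y a)))

    toℤ²-power : ∀ k → toℤ² (power k) ≡ ε ^ k
    toℤ²-power zero    = refl
    toℤ²-power (suc k) = trans (toℤ²-ε· (power k)) (cong (ε ·_) (toℤ²-power k))

    module _ (0<x : 0 ℕ.< x) (0<y : 0 ℕ.< y) where

      ε·-grows : ∀ {k} v → 0 ℕ.< proj₁ v × k ℕ.≤ proj₂ v → 0 ℕ.< proj₁ (ε· v) × suc k ℕ.≤ proj₂ (ε· v)
      ε·-grows {k} (a , b) (0<a , k≤b) =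
        ℕ.≤-trans (ℕ.*-mono-≤ 0<x 0<a) (ℕ.m≤m+n (x ℕ.* a) _) ,
        subst (suc k ℕ.≤_) (ℕ.+-comm (y ℕ.* a) (x ℕ.* b))
          (ℕ.+-mono-≤ (ℕ.*-mono-≤ 0<y 0<a) (ℕ.≤-trans k≤b (ℕ.m≤n*m b x {{>-nonZero 0<x}})))

      power-grows : ∀ k → 0 ℕ.< proj₁ (power k) × k ℕ.≤ proj₂ (power k)
      power-grows zero    = s≤s z≤n , z≤n
      power-grows (suc k) = ε·-grows (power k) (power-grows k)

    module _ (q : ℕ) .{{_ : NonZero q}} (norm-ε : norm ε ≡ 1ℤ) where

      residue : ℕ → Fin q
      residue a = fromℕ< (m%n<n a q)

      power-residues : Fin (suc (q ℕ.* q)) → Fin (q ℕ.* q)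
      power-residues k = combine (residue (proj₁ (power (toℕ k)))) (residue (proj₂ (power (toℕ k))))

      same-residue⇒≡-mod : ∀ {a b} → residue a ≡ residue b → + a ≡ + b mod + q
      same-residue⇒≡-mod {a} {b} eq =
        %-≡⇒≡-mod q (trans (sym (toℕ-fromℕ< (m%n<n a q))) (trans (cong toℕ eq) (toℕ-fromℕ< (m%n<n b q))))

      -- Pigeonhole on the q² residue pairs, then cancel the common power using conj ε · ε = 1.
      ε-period : ∃ λ p → ε ^ suc p ≋ 1# mod + q
      ε-period with pigeonhole (ℕ.n<1+n (q ℕ.* q)) power-residues
      ... | i , j , i<j , same with combine-injective _ _ _ _ same | ℕ.m≤n⇒∃[o]m+o≡n i<j
      ...   | same₁ , same₂ | p , i+1+p≡j =
        p , ≋-sym (^-cancelˡ {v = conj ε} (conj-· ε norm-ε) (toℕ i) (subst₂ (_≋_mod + q) (cong (ε ^_) i≡) (cong (ε ^_) j≡) ε^i≋ε^j))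
        where
        ε^i≋ε^j : ε ^ toℕ i ≋ ε ^ toℕ j mod + q
        ε^i≋ε^j = subst₂ (_≋_mod + q) (toℤ²-power (toℕ i)) (toℤ²-power (toℕ j))
                    (same-residue⇒≡-mod same₁ , same-residue⇒≡-mod same₂)
        i≡ : toℕ i ≡ toℕ i ℕ.+ 0
        i≡ = sym (ℕ.+-identityʳ (toℕ i))
        j≡ : toℕ j ≡ toℕ i ℕ.+ suc p
        j≡ = trans (sym i+1+p≡j) (sym (ℕ.+-suc (toℕ i) p))

    pell-orbit : ∀ q .{{_ : NonZero q}} → 0 ℕ.< x → 0 ℕ.< y → norm ε ≡ 1ℤ → ∀ N →
                 ∃₂ λ x′ y′ → N ℕ.< y′ × 0 ℕ.< x′ × norm (+ x′ , + y′) ≡ 1ℤ × (+ x′ , + y′) ≋ ε mod + q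
    pell-orbit q 0<x 0<y norm-ε N =
      proj₁ (power k) , proj₂ (power k) ,
      ℕ.<-≤-trans (s≤s (ℕ.m≤m*n N (suc p))) (proj₂ (power-grows 0<x 0<y k)) ,
      proj₁ (power-grows 0<x 0<y k) ,
      subst (λ u → norm u ≡ 1ℤ) (sym (toℤ²-power k)) (norm-^ ε k norm-ε) ,
      subst (_≋ ε mod + q) (sym (toℤ²-power k)) (^-periodic (suc p) (proj₂ (ε-period q norm-ε)) N)
      where
      p = proj₁ (ε-period q norm-ε)
      k = suc (N ℕ.* suc p)

module PellInequalities where
  open import Data.Nat using (ℕ; suc; _+_; _*_; _<_; _≤_; _≤?_; s≤s)
  open import Data.Nat.Properties using (+-comm; *-distribˡ-+; ≰⇒>; <⇒≱; *-mono-≤; *-mono-<; +-cancelʳ-<; +-monoʳ-<; m≤m+n)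
  open import Data.Nat.Tactic.RingSolver using (solve-∀; solve)
  open import Data.List using (_∷_; [])
  open import Relation.Binary.PropositionalEquality using (_≡_; sym; cong; subst; module ≡-Reasoning)
  open import Relation.Nullary using (yes; no)
  open import Data.Empty using (⊥-elim)
  open ≡-Reasoning

  ≤-by : ∀ {a b} d → b ≡ a + d → a ≤ b
  ≤-by {a} d b≡ = subst (a ≤_) (sym b≡) (m≤m+n a d)

  <-by : ∀ {a b} d → b ≡ suc (a + d) → a < b
  <-by d b≡ = ≤-by d b≡

  square-cancel-< : ∀ {a b} → a * a < b * b → a < b
  square-cancel-< {a} {b} a²<b² with b ≤? a
  ... | no  b≰a = ≰⇒> b≰a
  ... | yes b≤a = ⊥-elim (<⇒≱ a²<b² (*-mono-≤ b≤a b≤a))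

  module _ {k x y : ℕ} (pell : x * x ≡ (2 + k) * (y * y) + 1) where

    pell-y<x : y < x
    pell-y<x = square-cancel-< (<-by ((1 + k) * (y * y)) (begin
      x * x                            ≡⟨ pell ⟩
      (2 + k) * (y * y) + 1            ≡⟨ solve (k ∷ y ∷ []) ⟩
      suc (y * y + (1 + k) * (y * y))  ∎))

    pell-x<my : 0 < y → x < (2 + k) * y
    pell-x<my (s≤s {n = y′} _) = square-cancel-< (<-by ((k * k + 3 * k) * (y * y) + 2 * (y′ * y′ + 2 * y′)) (begin
      (2 + k) * y * ((2 + k) * y)                                                  ≡⟨ solve (k ∷ y′ ∷ []) ⟩
      suc ((2 + k) * (y * y) + 1 + ((k * k + 3 * k) * (y * y) + 2 * (y′ * y′ + 2 * y′))) ≡⟨ cong (λ z → suc (z + ((k * k + 3 * k) * (y * y) + 2 * (y′ * y′ + 2 * y′)))) pell ⟨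
      suc (x * x + ((k * k + 3 * k) * (y * y) + 2 * (y′ * y′ + 2 * y′)))           ∎))

    -- If 4A < y then (4m − 1)y < 4x, but ((4m − 1)y)² > 16(my² + 1) = (4x)² for m ≥ 2.
    pell-conjugate-bound : 0 < y → ∀ {A} → A + x ≡ (2 + k) * y → y ≤ 4 * A
    pell-conjugate-bound (s≤s {n = y′} _) {A} A+x≡ with y ≤? 4 * A
    ... | yes y≤4A = y≤4A
    ... | no  y≰4A = ⊥-elim (<⇒≱ (*-mono-< c<4x c<4x) 4x²≤c²)
      where
      c = (7 + 4 * k) * y
      r = 1 + (40 * k + 16 * k * k) * (y * y) + 17 * (y′ * y′ + 2 * y′)
      4x²≤c² : 4 * x * (4 * x) ≤ c * c
      4x²≤c² = ≤-by r (begin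
        c * c                             ≡⟨ ring k y′ ⟩
        16 * ((2 + k) * (y * y) + 1) + r  ≡⟨ cong (λ z → 16 * z + r) pell ⟨
        16 * (x * x) + r                  ≡⟨ cong (_+ r) (solve (x ∷ [])) ⟩
        4 * x * (4 * x) + r               ∎)
        where
        ring : ∀ k y′ → (7 + 4 * k) * suc y′ * ((7 + 4 * k) * suc y′) ≡ 16 * ((2 + k) * (suc y′ * suc y′) + 1) + (1 + (40 * k + 16 * k * k) * (suc y′ * suc y′) + 17 * (y′ * y′ + 2 * y′))
        ring = solve-∀
      c<4x : c < 4 * x
      c<4x = +-cancelʳ-< (4 * A) c (4 * x) (subst (c + 4 * A <_) c+y≡ (+-monoʳ-< c (≰⇒> y≰4A)))
        where
        c+y≡ : c + y ≡ 4 * x + 4 * A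
        c+y≡ = begin
          c + y              ≡⟨ ring k y′ ⟩
          4 * ((2 + k) * y)  ≡⟨ cong (4 *_) A+x≡ ⟨
          4 * (A + x)        ≡⟨ *-distribˡ-+ 4 A x ⟩
          4 * A + 4 * x      ≡⟨ +-comm (4 * A) (4 * x) ⟩
          4 * x + 4 * A      ∎
          where
          ring : ∀ k y′ → (7 + 4 * k) * suc y′ + suc y′ ≡ 4 * ((2 + k) * suc y′)
          ring = solve-∀

open import Defs
open PolygonalNumbers
open Modulus
open QuadraticIntegers
open PellOrbits
open PellInequalities
open import Data.Nat using (ℕ; zero; suc; _<_; _≤_; _*_; _∸_; NonZero; >-nonZero; z≤n; s≤s)
import Data.Nat as ℕ
import Data.Nat.Properties as ℕ
import Data.Nat.Divisibility as ℕ
open import Data.Integer using (+_; _+_; _-_; 1ℤ) renaming (_*_ to _*ℤ_)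
open import Data.Integer.Properties using (pos-+; pos-*; +-injective; m-n≡m⊖n; ⊖-≥; *-identityʳ)
open import Data.Integer.Divisibility using (_∣_)
open import Data.Integer.Divisibility.Signed using (∣⇒∣ᵤ; ∣ᵤ⇒∣)
open import Data.Integer.Tactic.RingSolver using (solve-∀)
open import Data.Product using (_×_; ∃₂; _,_; proj₁; proj₂)
open import Data.Sum using (_⊎_; inj₁; inj₂)
open import Relation.Binary.PropositionalEquality using (_≡_; _≢_; sym; trans; cong; cong₂; subst; module ≡-Reasoning)
open ≡-Reasoning

CongruenceCondition : ℕ → ℕ → ℕ → ℕ → Set
CongruenceCondition m q x y =
  (((+ q) ∣ ((+ x) + (+ m) *ℤ (+ y) + + 1)) × ((+ q) ∣ ((+ x) + (+ y) + + 1)))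
  ⊎ (((+ q) ∣ ((+ m) *ℤ (+ y) - (+ x) + + 1)) × ((+ q) ∣ ((+ x) - (+ y) + + 1)))

∣ᵤ-resp-mod : ∀ {q a b} → a ≡ b mod + q → (+ q) ∣ b → (+ q) ∣ a
∣ᵤ-resp-mod a≡b q∣b = ∣⇒∣ᵤ (∣-resp-mod a≡b (∣ᵤ⇒∣ q∣b))

congruence-condition-mod : ∀ {m q x y x′ y′} → (+ x′ , + y′) ≋ (+ x , + y) mod + q →
                           CongruenceCondition m q x y → CongruenceCondition m q x′ y′
congruence-condition-mod {m} (x′≡ , y′≡) (inj₁ (q∣A+1 , q∣B+1)) =
  inj₁ (∣ᵤ-resp-mod (+-cong-mod (+-cong-mod x′≡ (*-cong-mod (mod-refl {a = + m}) y′≡)) (mod-refl {a = + 1})) q∣A+1 ,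
        ∣ᵤ-resp-mod (+-cong-mod (+-cong-mod x′≡ y′≡) (mod-refl {a = + 1})) q∣B+1)
congruence-condition-mod {m} (x′≡ , y′≡) (inj₂ (q∣A+1 , q∣B+1)) =
  inj₂ (∣ᵤ-resp-mod (+-cong-mod (-‿cong-mod (*-cong-mod (mod-refl {a = + m}) y′≡) x′≡) (mod-refl {a = + 1})) q∣A+1 ,
        ∣ᵤ-resp-mod (+-cong-mod (-‿cong-mod x′≡ y′≡) (mod-refl {a = + 1})) q∣B+1)

ShiftedPair : ℕ → ℕ → ℕ → Set
ShiftedPair m q y = ∃₂ λ A B → q ℕ.∣ A ℕ.+ 1 × q ℕ.∣ B ℕ.+ 1 × A * A ℕ.+ m ≡ m * (B * B) ℕ.+ 1 × y ≤ 4 * A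

-≡-⇒+≡+ : ∀ {a b c d} → + a - + b ≡ + c - + d → a ℕ.+ d ≡ b ℕ.+ c
-≡-⇒+≡+ {a} {b} {c} {d} eq = +-injective (begin
  + (a ℕ.+ d)               ≡⟨ pos-+ a d ⟩
  + a + + d                 ≡⟨ ring (+ a) (+ b) (+ d) ⟩
  (+ a - + b) + (+ b + + d) ≡⟨ cong (_+ (+ b + + d)) eq ⟩
  (+ c - + d) + (+ b + + d) ≡⟨ ring′ (+ b) (+ c) (+ d) ⟩
  + b + + c                 ≡⟨ pos-+ b c ⟨
  + (b ℕ.+ c)               ∎)
  where
  ring : ∀ a b d → a + d ≡ (a - b) + (b + d)
  ring = solve-∀
  ring′ : ∀ b c d → (c - d) + (b + d) ≡ b + c
  ring′ = solve-∀

norm≡⇒ℕ : ∀ {m a b c d} → + a *ℤ + a - + m *ℤ (+ b *ℤ + b) ≡ + c - + d → a * a ℕ.+ d ≡ m * (b * b) ℕ.+ c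
norm≡⇒ℕ {m} {a} {b} {c} {d} eq = -≡-⇒+≡+ {a * a} {m * (b * b)} {c} {d} (trans (cong₂ _-_ (pos-* a a) (trans (pos-* m (b * b)) (cong (+ m *ℤ_) (pos-* b b)))) eq)

pos-∸ : ∀ {a b} → b ≤ a → + (a ∸ b) ≡ + a - + b
pos-∸ {a} {b} b≤a = sym (trans (m-n≡m⊖n a b) (⊖-≥ b≤a))

shifted-norm : ∀ {m x y A B} → + x *ℤ + x - + m *ℤ (+ y *ℤ + y) ≡ 1ℤ →
               + A *ℤ + A - + m *ℤ (+ B *ℤ + B) ≡ (1ℤ - + m) *ℤ (+ x *ℤ + x - + m *ℤ (+ y *ℤ + y)) →
               A * A ℕ.+ m ≡ m * (B * B) ℕ.+ 1
shifted-norm {m} {A = A} {B} pell AB-norm =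
  norm≡⇒ℕ {m} {A} {B} {1} {m} (trans AB-norm (trans (cong ((1ℤ - + m) *ℤ_) pell) (*-identityʳ (1ℤ - + m))))

-- (A + B√m) = (±1 + √m)(x + y√m), so A² − mB² = (1 − m)(x² − my²) = 1 − m.
shifted-pair : ∀ {m q x y} → 1 < m → 0 < y → + x *ℤ + x - + m *ℤ (+ y *ℤ + y) ≡ 1ℤ →
               CongruenceCondition m q x y → ShiftedPair m q y
shifted-pair {m} {q} {x} {y} 1<m 0<y pell (inj₁ (q∣A+1 , q∣B+1)) =
  A , B , subst (λ n → (+ q) ∣ n) A+1≡ q∣A+1 , subst (λ n → (+ q) ∣ n) B+1≡ q∣B+1 ,
  shifted-norm {m} {x} {y} {A} {B} pell (trans (cong₂ (λ a b → a *ℤ a - + m *ℤ (b *ℤ b)) A≡ (pos-+ x y)) (ring (+ x) (+ y) (+ m))) ,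
  ℕ.≤-trans (ℕ.m≤n*m y m {{>-nonZero (ℕ.<-trans (s≤s z≤n) 1<m)}}) (ℕ.≤-trans (ℕ.m≤n+m (m * y) x) (ℕ.m≤n*m A 4))
  where
  A = x ℕ.+ m * y
  B = x ℕ.+ y
  A≡ : + A ≡ + x + + m *ℤ + y
  A≡ = trans (pos-+ x (m * y)) (cong (_+_ (+ x)) (pos-* m y))
  A+1≡ : + x + + m *ℤ + y + + 1 ≡ + (A ℕ.+ 1)
  A+1≡ = sym (trans (pos-+ A 1) (cong (_+ + 1) A≡))
  B+1≡ : + x + + y + + 1 ≡ + (B ℕ.+ 1)
  B+1≡ = sym (trans (pos-+ B 1) (cong (_+ + 1) (pos-+ x y)))
  ring : ∀ X Y M → (X + M *ℤ Y) *ℤ (X + M *ℤ Y) - M *ℤ ((X + Y) *ℤ (X + Y)) ≡ (1ℤ - M) *ℤ (X *ℤ X - M *ℤ (Y *ℤ Y))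
  ring = solve-∀
shifted-pair {suc zero} (s≤s ()) _ _ (inj₂ _)
shifted-pair {suc (suc k)} {q} {x} {y} _ 0<y pell (inj₂ (q∣A+1 , q∣B+1)) =
  A , B , subst (λ n → (+ q) ∣ n) A+1≡ q∣A+1 , subst (λ n → (+ q) ∣ n) B+1≡ q∣B+1 ,
  shifted-norm {m} {x} {y} {A} {B} pell (trans (cong₂ (λ a b → a *ℤ a - + m *ℤ (b *ℤ b)) A≡ B≡) (ring (+ x) (+ y) (+ m))) ,
  pell-conjugate-bound {k} {x} {y} pellℕ 0<y (ℕ.m∸n+n≡m x≤my)
  where
  m = suc (suc k)
  pellℕ : x * x ≡ m * (y * y) ℕ.+ 1
  pellℕ = trans (sym (ℕ.+-identityʳ (x * x))) (norm≡⇒ℕ {m} {x} {y} {1} {0} pell)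
  x≤my : x ≤ m * y
  x≤my = ℕ.<⇒≤ (pell-x<my {k} {x} {y} pellℕ 0<y)
  A = m * y ∸ x
  B = x ∸ y
  A≡ : + A ≡ + m *ℤ + y - + x
  A≡ = trans (pos-∸ x≤my) (cong (_- + x) (pos-* m y))
  B≡ : + B ≡ + x - + y
  B≡ = pos-∸ (ℕ.<⇒≤ (pell-y<x {k} {x} {y} pellℕ))
  A+1≡ : + m *ℤ + y - + x + + 1 ≡ + (A ℕ.+ 1)
  A+1≡ = sym (trans (pos-+ A 1) (cong (_+ + 1) A≡))
  B+1≡ : + x - + y + + 1 ≡ + (B ℕ.+ 1)
  B+1≡ = sym (trans (pos-+ B 1) (cong (_+ + 1) B≡))
  ring : ∀ X Y M → (M *ℤ Y - X) *ℤ (M *ℤ Y - X) - M *ℤ ((X - Y) *ℤ (X - Y)) ≡ (1ℤ - M) *ℤ (X *ℤ X - M *ℤ (Y *ℤ Y))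
  ring = solve-∀

theorem4 : (m ℓ : ℕ) → 1 < m → (∀ k → k * k ≢ m) → 5 ≤ ℓ →
    (∃₂ λ (x y : ℕ) → 0 < x × 0 < y × (+ x) *ℤ (+ x) - (+ m) *ℤ ((+ y) *ℤ (+ y)) ≡ + 1 ×
      ((((+ qOf ℓ) ∣ ((+ x) + (+ m) *ℤ (+ y) + + 1)) × ((+ qOf ℓ) ∣ ((+ x) + (+ y) + + 1)))
      ⊎ (((+ qOf ℓ) ∣ ((+ m) *ℤ (+ y) - (+ x) + + 1)) × ((+ qOf ℓ) ∣ ((+ x) - (+ y) + + 1))))) →
    (∃₂ λ (r s : ℕ) → 0 < r × 0 < s × P ℓ r ≡ m * P ℓ s)
    × (∀ (N : ℕ) → ∃₂ λ (r s : ℕ) → N < r × 0 < s × P ℓ r ≡ m * P ℓ s)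
theorem4 m ℓ 1<m _ 5≤ℓ@(s≤s (s≤s (s≤s (s≤s (s≤s {n = c′} _))))) (x , y , 0<x , 0<y , pell , condition) =
  solutions 0 , solutions
  where
  c = suc c′
  D = 2 * (2 ℕ.+ c)
  q = qOf ℓ
  admissible = qOf-admissible ℓ 5≤ℓ
  instance
    _ : NonZero q
    _ = >-nonZero (proj₁ admissible)
  open PellOrbit m x y using (pell-orbit)

  solutions : ∀ N → ∃₂ λ r s → N < r × 0 < s × P ℓ r ≡ m * P ℓ s
  solutions N =
    let x′ , y′ , 4DN<y′ , _ , pell′ , x′y′≋xy = pell-orbit q 0<x 0<y pell (4 * (D * N))
        A , B , q∣A+1 , q∣B+1 , AB-norm , y′≤4A =
          shifted-pair {m} {q} {x′} {y′} 1<m (ℕ.≤-<-trans z≤n 4DN<y′) pell′ (congruence-condition-mod {m} {q} {x} {y} x′y′≋xy condition)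
        r , s , A<Dr , 0<s , P≡mP = polygonal-solution c m q (s≤s z≤n) (proj₂ admissible) q∣A+1 q∣B+1 AB-norm
        4DN<4Dr = ℕ.<-≤-trans 4DN<y′ (ℕ.≤-trans y′≤4A (ℕ.<⇒≤ (ℕ.*-monoʳ-< 4 A<Dr)))
    in r , s , ℕ.*-cancelˡ-< D N r (ℕ.*-cancelˡ-< 4 (D * N) (D * r) 4DN<4Dr) , 0<s , P≡mP
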